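{- Let $G$ be a finite simple bipartite $2$-degenerate graph with maximum degree at most $4$. Then $G$ has a $2$-linear coloring in which there is no monochromatic vertex.
   Context: A graph is $2$-degenerate if every subgraph of it has a vertex of degree at most $2$. A linear forest is a forest each of whose components is a path. A $2$-linear coloring of $G$ is a map $c:E(G)\to\{1,2\}$ such that each color class forms a linear forest. Given a $2$-linear coloring of $G$, a vertex is called monochromatic if it has degree exactly $2$ in $G$ and both edges incident with it receive the same color. -}

module Defs where

open import Data.Nat using (ℕ; _≤_; _+_)
open import Data.Fin using (Fin)
open import Data.Fin.Properties using (_≟_)
open import Data.Bool using (Bool; true; false; _∧_)
open import Data.List using (List; []; _∷_; _++_; length; filterᵇ; allFin)
open import Data.List.Relation.Unary.Unique.Propositional using (Unique)
open import Data.Product using (Σ; _×_; ∃)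
open import Data.Unit using (⊤)
open import Relation.Nullary using (¬_)
open import Relation.Nullary.Decidable using (⌊_⌋)
open import Relation.Binary.PropositionalEquality using (_≡_)

Rel : ℕ → Set
Rel n = Fin n → Fin n → Bool

record Graph (n : ℕ) : Set where
  field
    adj    : Rel n
    sym    : ∀ u v → adj u v ≡ adj v u
    irrefl : ∀ v → adj v v ≡ false
open Graph public

degree : {n : ℕ} → Rel n → Fin n → ℕ
degree {n} A v = length (filterᵇ (A v) (allFin n))

record Subgraph {n : ℕ} (G : Graph n) : Set where
  field
    vs     : Fin n → Bool
    es     : Rel n
    es-sym : ∀ u v → es u v ≡ es v u
    es-sub : ∀ u v → es u v ≡ true → (adj G u v ≡ true) × (vs u ≡ true) × (vs v ≡ true)
open Subgraph public

TwoDegenerate : {n : ℕ} → Graph n → Set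
TwoDegenerate G =
  (H : Subgraph G) → ∃ (λ v → vs H v ≡ true) →
  ∃ (λ v → (vs H v ≡ true) × (degree (es H) v ≤ 2))

Bipartite : {n : ℕ} → Graph n → Set
Bipartite {n} G = Σ (Fin n → Bool) λ f → ∀ u v → adj G u v ≡ true → ¬ (f u ≡ f v)

MaxDegreeAtMost : {n : ℕ} → Graph n → ℕ → Set
MaxDegreeAtMost G k = ∀ v → degree (adj G) v ≤ k

AdjChain : {n : ℕ} → Rel n → List (Fin n) → Set
AdjChain A []            = ⊤
AdjChain A (x ∷ [])      = ⊤
AdjChain A (x ∷ y ∷ xs)  = (A x y ≡ true) × AdjChain A (y ∷ xs)

HasCycle : {n : ℕ} → Rel n → Set
HasCycle {n} A = Σ (Fin n) λ x → Σ (List (Fin n)) λ xs →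
  (2 ≤ length xs) × Unique (x ∷ xs) × AdjChain A (x ∷ xs ++ x ∷ [])

LinearForest : {n : ℕ} → Rel n → Set
LinearForest A = ¬ HasCycle A × (∀ v → degree A v ≤ 2)

record EdgeColouring {n : ℕ} (G : Graph n) : Set where
  field
    col     : Fin n → Fin n → Fin 2
    col-sym : ∀ u v → adj G u v ≡ true → col u v ≡ col v u
open EdgeColouring public

colourClass : {n : ℕ} {G : Graph n} → EdgeColouring G → Fin 2 → Rel n
colourClass {G = G} c i u v = adj G u v ∧ ⌊ col c u v ≟ i ⌋

TwoLinearColouring : {n : ℕ} {G : Graph n} → EdgeColouring G → Set
TwoLinearColouring c = ∀ i → LinearForest (colourClass c i)

Monochromatic : {n : ℕ} {G : Graph n} → EdgeColouring G → Fin n → Set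
Monochromatic {G = G} c v =
  (degree (adj G) v ≡ 2) ×
  (∀ u w → adj G v u ≡ true → adj G v w ≡ true → col c v u ≡ col c v w)

{-# OPTIONS --safe #-}
module Submission where

-- Order the vertices so that each has at most two later neighbours (2-degeneracy), list the
-- neighbours of every vertex with its later neighbours first, and pair up consecutive entries
-- of that list. It suffices to colour the edges so that edges paired at a common vertex get
-- different colours: then a vertex of degree at most 4 meets each colour at most twice, a vertex
-- of degree 2 meets both colours, and in each colour class every vertex has at most one later
-- neighbour, which rules out cycles (the earliest vertex of a cycle would have two). In a
-- bipartite graph, pairing edges at vertices of one side is a matching on the edge set and
-- pairing them at the other side is a second one; a union of two matchings has only even
-- cycles, hence is 2-colourable.

open import Data.Bool using (Bool; true; false; T; not; _∧_; _∨_; _xor_; if_then_else_)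
open import Data.Bool.Properties
  using (∧-comm; T-∧; T-≡; ¬-not; not-¬; not-injective; not-distribʳ-xor; xor-assoc)
  renaming (_≟_ to _≟ᵇ_)
open import Data.Empty using (⊥; ⊥-elim)
open import Data.Fin using (Fin; zero; suc)
open import Data.Fin.Properties using (_≟_; any?)
open import Data.List
  using (List; []; _∷_; _++_; _∷ʳ_; length; filterᵇ; allFin; cartesianProduct; initLast; _∷ʳ′_)
open import Data.List.Membership.Propositional using (_∈_; _∉_)
open import Data.List.Membership.Propositional.Properties
  using (∈-allFin; ∈-cartesianProduct⁺; ∈-filter⁺; ∈-filter⁻; ∈-++⁺ʳ)
open import Data.List.Properties using (++-assoc; length-filter; filter-notAll)
open import Data.List.Relation.Binary.Permutation.Propositional
  using (_↭_; prep; ↭-refl; ↭-sym; ↭-trans; ↭⇒↭ₛ)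
open import Data.List.Relation.Binary.Permutation.Propositional.Properties
  using (shift; ↭-length; filter-↭; ∈-resp-↭)
import Data.List.Relation.Binary.Permutation.Setoid.Properties as Permutationₛ
open import Data.List.Relation.Binary.Sublist.Heterogeneous.Properties using (length-mono-≤)
open import Data.List.Relation.Binary.Sublist.Propositional using (⊆-refl)
import Data.List.Relation.Binary.Sublist.Propositional.Properties as Sublist
open import Data.List.Relation.Unary.All as All using (All; _∷_)
open import Data.List.Relation.Unary.AllPairs using (_∷_)
open import Data.List.Relation.Unary.Any as Any using (here; there)
open import Data.List.Relation.Unary.Linked using (Linked; [-]; _∷_)
open import Data.List.Relation.Unary.Linked.Properties using (Linked⇒AllPairs)
open import Data.List.Relation.Unary.Unique.Propositional using (Unique)
open import Data.List.Relation.Unary.Unique.Propositional.Properties using (filter⁺; allFin⁺)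
open import Data.Maybe using (Maybe; just; nothing)
import Data.Maybe as Maybe
open import Data.Maybe.Properties using (just-injective)
open import Data.Nat using (ℕ; suc; _≤_; _<_; _>_; _<ᵇ_; z≤n; s≤s; s<s⁻¹; ⌈_/2⌉)
open import Data.Nat.Induction using (<-wellFounded)
open import Data.Nat.Properties
  using (≤-refl; ≤-trans; n≤1+n; <-cmp; <-trans; <-irrefl; <-asym; suc-injective; <ᵇ⇒<; <⇒<ᵇ; ⌈n/2⌉-mono;
         module ≤-Reasoning)
open import Data.Product using (Σ; ∃; _×_; _,_; proj₁; proj₂)
open import Data.Product.Properties using (≡-dec)
open import Data.Sum using (_⊎_; inj₁; inj₂; [_,_]′)
import Data.Sum as Sum
open import Data.Unit using (⊤; tt)
open import Function using (id; _∘_; _∘′_; _$_; _on_; Equivalence)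
open import Induction.WellFounded using (Acc; acc)
open import Relation.Binary.Definitions using (DecidableEquality; tri<; tri≈; tri>)
open import Relation.Binary.PropositionalEquality
open import Relation.Nullary using (Dec; does; yes; no; ¬_; contradiction)
open import Relation.Nullary.Decidable using (T?; ⌊_⌋; dec-true; dec-false; toWitness; fromWitness)

open import Defs hiding (sym)

private variable
  A : Set

filterᵇ-∧ : ∀ (p q : A → Bool) l → filterᵇ (λ x → p x ∧ q x) l ≡ filterᵇ q (filterᵇ p l)
filterᵇ-∧ p q [] = refl
filterᵇ-∧ p q (x ∷ l) with p x
... | false = filterᵇ-∧ p q l
... | true with q x
...   | true  = cong (x ∷_) (filterᵇ-∧ p q l)
...   | false = filterᵇ-∧ p q l

length-filterᵇ-mono : ∀ {p q : A → Bool} → (∀ {x} → T (p x) → T (q x)) → ∀ l →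
                      length (filterᵇ p l) ≤ length (filterᵇ q l)
length-filterᵇ-mono {p = p} {q} p⇒q l =
  length-mono-≤ (Sublist.filter⁺ (T? ∘ p) (T? ∘ q) (λ { refl → p⇒q }) (⊆-refl {x = l}))

filterᵇ-partition-↭ : ∀ (p : A → Bool) l → filterᵇ p l ++ filterᵇ (not ∘ p) l ↭ l
filterᵇ-partition-↭ p []      = ↭-refl
filterᵇ-partition-↭ p (x ∷ l) with p x
... | true  = prep x (filterᵇ-partition-↭ p l)
... | false = ↭-trans (shift x (filterᵇ p l) (filterᵇ (not ∘ p) l)) (prep x (filterᵇ-partition-↭ p l))

∧-≡-true : ∀ {a b} → a ∧ b ≡ true → a ≡ true × b ≡ true
∧-≡-true {true} b≡true = refl , b≡true

xor-≢ : ∀ d {a b} → a ≢ b → d xor a ≢ d xor b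
xor-≢ false a≢b = a≢b
xor-≢ true  a≢b = a≢b ∘′ not-injective

xor-assoc-≢ : ∀ d {a b s t} → a xor s ≢ b xor t → (d xor a) xor s ≢ (d xor b) xor t
xor-assoc-≢ d {a} {b} {s} {t} ne rewrite xor-assoc d a s | xor-assoc d b t = xor-≢ d ne

not-xor-xor : ∀ a b → not (a xor b) xor b ≡ not a
not-xor-xor false false = refl
not-xor-xor false true  = refl
not-xor-xor true  false = refl
not-xor-xor true  true  = refl

not-xor-xor-not : ∀ a b t → not (a xor b) xor not (b xor t) ≡ a xor t
not-xor-xor-not false false false = refl
not-xor-xor-not false false true  = refl
not-xor-xor-not false true  false = refl
not-xor-xor-not false true  true  = refl
not-xor-xor-not true  false false = refl
not-xor-xor-not true  false true  = refl
not-xor-xor-not true  true  false = refl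
not-xor-xor-not true  true  true  = refl

-- Pairing up consecutive entries of a list

module Pairing {A : Set} (_≟_ : DecidableEquality A) where

  partner : List A → A → Maybe A
  partner (a ∷ b ∷ l) x with x ≟ a | x ≟ b
  ... | yes _ | _     = just b
  ... | no _  | yes _ = just a
  ... | no _  | no _  = partner l x
  partner _ x = nothing

  private variable
    a b x y : A
    l : List A

  partner-first : partner (a ∷ b ∷ l) a ≡ just b
  partner-first {a} with a ≟ a
  ... | yes _   = refl
  ... | no a≢a = contradiction refl a≢a

  partner-second : a ≢ b → partner (a ∷ b ∷ l) b ≡ just a
  partner-second {a} {b} a≢b with b ≟ a | b ≟ b
  ... | yes b≡a | _      = contradiction (sym b≡a) a≢b
  ... | no _    | yes _  = refl
  ... | no _    | no b≢b = contradiction refl b≢b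

  partner-∈ : partner l x ≡ just y → x ∈ l × y ∈ l
  partner-∈ {a ∷ b ∷ l} {x} eq with x ≟ a | x ≟ b | eq
  ... | yes refl | _        | refl = here refl , there (here refl)
  ... | no _     | yes refl | refl = there (here refl) , here refl
  ... | no _     | no _     | eq′  = let x∈l , y∈l = partner-∈ eq′
                                     in there (there x∈l) , there (there y∈l)

  partner-tail : Unique (a ∷ b ∷ l) → partner l x ≡ just y → partner (a ∷ b ∷ l) x ≡ just y
  partner-tail {a} {b} {x = x} ((_ ∷ a∉l) ∷ b∉l ∷ _) eq with x ≟ a | x ≟ b
  ... | yes refl | _        = contradiction refl (All.lookup a∉l (proj₁ (partner-∈ eq)))
  ... | no _     | yes refl = contradiction refl (All.lookup b∉l (proj₁ (partner-∈ eq)))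
  ... | no _     | no _     = eq

  partner-sym : Unique l → partner l x ≡ just y → partner l y ≡ just x
  partner-sym {a ∷ b ∷ l} {x} u@((a≢b ∷ _) ∷ _ ∷ u′) eq with x ≟ a | x ≟ b | eq
  ... | yes refl | _        | refl = partner-second a≢b
  ... | no _     | yes refl | refl = partner-first
  ... | no _     | no _     | eq′  = partner-tail u (partner-sym u′ eq′)

  partner-irrefl : Unique l → partner l x ≡ just y → x ≢ y
  partner-irrefl {a ∷ b ∷ l} {x} ((a≢b ∷ _) ∷ _ ∷ u′) eq with x ≟ a | x ≟ b | eq
  ... | yes refl | _        | refl = a≢b
  ... | no _     | yes refl | refl = a≢b ∘ sym
  ... | no _     | no _     | eq′  = partner-irrefl u′ eq′

  partner-prefix : ∀ {h} l → length h ≤ 2 → x ∈ h → y ∈ h → x ≢ y → partner (h ++ l) x ≡ just y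
  partner-prefix {h = _ ∷ []}        _ _ (here refl) (here refl) x≢y = contradiction refl x≢y
  partner-prefix {h = _ ∷ _ ∷ []}    _ _ (here refl) (here refl) x≢y = contradiction refl x≢y
  partner-prefix {h = _ ∷ _ ∷ []}    _ _ (here refl) (there (here refl)) _ = partner-first
  partner-prefix {h = _ ∷ _ ∷ []}    _ _ (there (here refl)) (here refl) x≢y = partner-second (x≢y ∘ sym)
  partner-prefix {h = _ ∷ _ ∷ []}    _ _ (there (here refl)) (there (here refl)) x≢y = contradiction refl x≢y
  partner-prefix {h = _ ∷ _ ∷ _ ∷ _} _ (s≤s (s≤s ())) _ _ _

  Separated : (A → Bool) → List A → Set
  Separated p l = ∀ {x y} → partner l x ≡ just y → T (p x) → T (p y) → ⊥

  length-filterᵇ-separated : ∀ p → Unique l → Separated p l → length (filterᵇ p l) ≤ ⌈ length l /2⌉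
  length-filterᵇ-separated {[]}     p _ _ = z≤n
  length-filterᵇ-separated {a ∷ []} p _ _ = length-filter (T? ∘ p) (a ∷ [])
  length-filterᵇ-separated {a ∷ b ∷ l} p u@(_ ∷ _ ∷ u′) separated =
    ≤-trans (at-most-one (separated partner-first))
            (s≤s (length-filterᵇ-separated p u′ (separated ∘ partner-tail u)))
    where
    at-most-one : (T (p a) → T (p b) → ⊥) → length (filterᵇ p (a ∷ b ∷ l)) ≤ suc (length (filterᵇ p l))
    at-most-one not-both with p a
    ... | true with p b
    ...   | true  = ⊥-elim (not-both tt tt)
    ...   | false = ≤-refl
    at-most-one not-both | false with p b
    ...   | true  = ≤-refl
    ...   | false = n≤1+n _

-- Two-colouring a union of two matchings

module UnionOfTwoMatchings
  {X : Set} (_≟_ : DecidableEquality X)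
  (m : Bool → X → Maybe X)
  (m-sym : ∀ {t x y} → m t x ≡ just y → m t y ≡ just x)
  (m-irrefl : ∀ {t x y} → m t x ≡ just y → x ≢ y)
  where

  -- inserted t x records whether the edge of the matching m t at x has been inserted;
  -- component sends every vertex to a label of its component in the graph of inserted edges.
  record State : Set where
    field
      component : X → X
      colour    : X → Bool
      inserted  : Bool → X → Bool
  open State

  -- Each component of the inserted edges is an alternating path or cycle. A vertex missing its
  -- s-edge is an end of a path, and two ends missing their s- and t-edges are joined by a path
  -- of odd length exactly when s = t.
  record Invariant (σ : State) : Set where
    field
      proper    : ∀ {t x y} → m t x ≡ just y → inserted σ t x ≡ true →
                  colour σ x ≢ colour σ y × component σ x ≡ component σ y
      open-ends : ∀ {s t x y} → component σ x ≡ component σ y → x ≢ y →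
                  inserted σ s x ≡ false → inserted σ t y ≡ false →
                  colour σ x xor s ≢ colour σ y xor t
  open Invariant

  _⊑_ : State → State → Set
  σ ⊑ σ′ = ∀ {t z} → inserted σ t z ≡ true → inserted σ′ t z ≡ true

  Covered : State → Bool → X → Set
  Covered σ t x = ∀ {y} → m t x ≡ just y → inserted σ t x ≡ true ⊎ inserted σ t y ≡ true

  Covered-mono : ∀ {σ σ′ t x} → σ ⊑ σ′ → Covered σ t x → Covered σ′ t x
  Covered-mono σ⊑σ′ covered mxy = Sum.map σ⊑σ′ σ⊑σ′ (covered mxy)

  initial : State
  initial = record { component = id ; colour = λ _ → false ; inserted = λ _ _ → false }

  initial-invariant : Invariant initial
  initial-invariant = record
    { proper    = λ _ ()
    ; open-ends = λ x≡y x≢y _ _ → contradiction x≡y x≢y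
    }

  insertEdge : Bool → X → X → State → State
  insertEdge t x y σ = record σ
    { inserted = λ s z → inserted σ s z ∨ (does (s ≟ᵇ t) ∧ (does (z ≟ x) ∨ does (z ≟ y))) }

  module _ {t : Bool} {x y : X} (σ : State) where

    inserted-insertEdge : ∀ {s z} → inserted (insertEdge t x y σ) s z ≡ true →
                          inserted σ s z ≡ true ⊎ (s ≡ t × (z ≡ x ⊎ z ≡ y))
    inserted-insertEdge {s} {z} _ with inserted σ s z | s ≟ᵇ t | z ≟ x | z ≟ y
    ... | true  | _       | _       | _       = inj₁ refl
    ... | false | yes s≡t | yes z≡x | _       = inj₂ (s≡t , inj₁ z≡x)
    ... | false | yes s≡t | no _    | yes z≡y = inj₂ (s≡t , inj₂ z≡y)

    open-insertEdge : ∀ {s z} → inserted (insertEdge t x y σ) s z ≡ false →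
                      inserted σ s z ≡ false × (s ≡ t → z ≢ x × z ≢ y)
    open-insertEdge {s} {z} _ with inserted σ s z | s ≟ᵇ t | z ≟ x | z ≟ y
    ... | false | no s≢t | _      | _      = refl , λ s≡t → contradiction s≡t s≢t
    ... | false | yes _  | no z≢x | no z≢y = refl , λ _ → z≢x , z≢y

    insertEdge-⊒ : σ ⊑ insertEdge t x y σ
    insertEdge-⊒ eq rewrite eq = refl

    insertEdge-covers : inserted (insertEdge t x y σ) t x ≡ true
    insertEdge-covers with inserted σ t x | t ≟ᵇ t | x ≟ x
    ... | true  | _      | _      = refl
    ... | false | yes _  | yes _  = refl
    ... | false | no t≢t | _      = contradiction refl t≢t
    ... | false | yes _  | no x≢x = contradiction refl x≢x

    insertEdge-proper : (P : X → X → Set) → m t x ≡ just y →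
      (∀ {s z w} → m s z ≡ just w → inserted σ s z ≡ true → P z w) → P x y → P y x →
      ∀ {s z w} → m s z ≡ just w → inserted (insertEdge t x y σ) s z ≡ true → P z w
    insertEdge-proper P mxy old Pxy Pyx mzw ins with inserted-insertEdge ins
    ... | inj₁ ins-old = old mzw ins-old
    ... | inj₂ (refl , inj₁ refl) rewrite just-injective (trans (sym mzw) mxy)         = Pxy
    ... | inj₂ (refl , inj₂ refl) rewrite just-injective (trans (sym mzw) (m-sym mxy)) = Pyx

  module Insert (σ : State) (I : Invariant σ) {t : Bool} {x y : X} (mxy : m t x ≡ just y)
                (x-open : inserted σ t x ≡ false) (y-open : inserted σ t y ≡ false) where

    close : component σ x ≡ component σ y → Invariant (insertEdge t x y σ)
    close same = record
      { proper    = insertEdge-proper σ _ mxy (proper I) (x≢y , same) (x≢y ∘ sym , sym same)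
      ; open-ends = λ eq a≢b a-open b-open →
          open-ends I eq a≢b (proj₁ (open-insertEdge σ a-open)) (proj₁ (open-insertEdge σ b-open))
      }
      where
      x≢y : colour σ x ≢ colour σ y
      x≢y = open-ends I same (m-irrefl mxy) x-open y-open ∘ cong (_xor t)

    δ : Bool
    δ = not (colour σ x xor colour σ y)

    component′ : X → X
    component′ z = if does (component σ z ≟ component σ y) then component σ x else component σ z

    colour′ : X → Bool
    colour′ z = if does (component σ z ≟ component σ y) then δ xor colour σ z else colour σ z

    merged : State
    merged = record σ { component = component′ ; colour = colour′ }

    data Side (z : X) : Set where
      fromY : component σ z ≡ component σ y → component′ z ≡ component σ x →
              colour′ z ≡ δ xor colour σ z → Side z
      other : component σ z ≢ component σ y → component′ z ≡ component σ z →
              colour′ z ≡ colour σ z → Side z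

    merged-fromY : ∀ {z} → component σ z ≡ component σ y →
                   component′ z ≡ component σ x × colour′ z ≡ δ xor colour σ z
    merged-fromY {z} zY rewrite dec-true (component σ z ≟ component σ y) zY = refl , refl

    merged-other : ∀ {z} → component σ z ≢ component σ y →
                   component′ z ≡ component σ z × colour′ z ≡ colour σ z
    merged-other {z} z∉Y rewrite dec-false (component σ z ≟ component σ y) z∉Y = refl , refl

    side : ∀ z → Side z
    side z with component σ z ≟ component σ y
    ... | yes zY = let c , χ = merged-fromY zY in fromY zY c χ
    ... | no z∉Y = let c , χ = merged-other z∉Y in other z∉Y c χ

    same-component : ∀ {z w} → component σ z ≡ component σ w →
      Σ Bool λ d → colour′ z ≡ d xor colour σ z × colour′ w ≡ d xor colour σ w ×
                   component′ z ≡ component′ w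
    same-component {z} {w} same with side z | side w
    ... | fromY _ cz χz   | fromY _ cw χw   = δ , χz , χw , trans cz (sym cw)
    ... | other _ cz χz   | other _ cw χw   = false , χz , χw , trans cz (trans same (sym cw))
    ... | fromY zY _ _    | other w∉Y _ _   = contradiction (trans (sym same) zY) w∉Y
    ... | other z∉Y _ _   | fromY wY _ _    = contradiction (trans same wY) z∉Y

    end-parity : ∀ {z a s} → z ≡ x ⊎ z ≡ y → inserted σ t z ≡ false → component σ a ≡ component σ z →
                 inserted (insertEdge t x y merged) s a ≡ false →
                 colour σ a xor s ≡ not (colour σ z xor t)
    end-parity {z} {a} {s} z∈xy z-open same a-open with open-insertEdge merged a-open | a ≟ z
    ... | a-open-σ , _     | no a≢z   = ¬-not (open-ends I same a≢z a-open-σ z-open)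
    ... | _        , new≢a | yes refl with s ≟ᵇ t
    ...   | yes s≡t = contradiction z∈xy [ proj₁ (new≢a s≡t) , proj₂ (new≢a s≡t) ]′
    ...   | no s≢t  rewrite ¬-not s≢t = sym (not-distribʳ-xor (colour σ a) t)

    module Merge (apart : component σ x ≢ component σ y) where

      new-edge : colour′ x ≢ colour′ y × component′ x ≡ component′ y
      new-edge with side x | side y
      ... | fromY xY _ _  | _             = contradiction xY apart
      ... | other _ _ _   | other y∉Y _ _ = contradiction refl y∉Y
      ... | other _ cx χx | fromY _ cy χy =
            (λ eq → not-¬ refl (trans (sym χx) (trans eq (trans χy (not-xor-xor _ _)))))
          , trans cx (sym cy)

      old-edge : ∀ {s z w} → m s z ≡ just w → inserted σ s z ≡ true →
                 colour′ z ≢ colour′ w × component′ z ≡ component′ w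
      old-edge mzw ins with proper I mzw ins
      ... | z≢w , same with same-component same
      ...   | d , χz , χw , cz≡cw = (λ eq → xor-≢ d z≢w (trans (sym χz) (trans eq χw))) , cz≡cw

      cross-ends : ∀ {a b s s′} → component σ a ≡ component σ y → component σ b ≡ component σ x →
                   colour′ a ≡ δ xor colour σ a → colour′ b ≡ colour σ b →
                   inserted (insertEdge t x y merged) s a ≡ false →
                   inserted (insertEdge t x y merged) s′ b ≡ false →
                   colour′ a xor s ≢ colour′ b xor s′
      cross-ends {a} {b} {s} {s′} aY bX χa χb a-open b-open eq = not-¬ refl $ begin
        colour σ x xor t                ≡⟨ not-xor-xor-not (colour σ x) (colour σ y) t ⟨
        δ xor not (colour σ y xor t)    ≡⟨ cong (δ xor_) (end-parity (inj₂ refl) y-open aY a-open) ⟨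
        δ xor (colour σ a xor s)        ≡⟨ xor-assoc δ (colour σ a) s ⟨
        (δ xor colour σ a) xor s        ≡⟨ cong (_xor s) χa ⟨
        colour′ a xor s                 ≡⟨ eq ⟩
        colour′ b xor s′                ≡⟨ cong (_xor s′) χb ⟩
        colour σ b xor s′               ≡⟨ end-parity (inj₁ refl) x-open bX b-open ⟩
        not (colour σ x xor t)          ∎
        where open ≡-Reasoning

      merged-open-ends : ∀ {s s′ a b} → component′ a ≡ component′ b → a ≢ b →
                         inserted (insertEdge t x y merged) s a ≡ false →
                         inserted (insertEdge t x y merged) s′ b ≡ false →
                         colour′ a xor s ≢ colour′ b xor s′
      merged-open-ends {a = a} {b} same′ a≢b a-open b-open with component σ a ≟ component σ b
      ... | yes same with same-component same
      ...   | d , χa , χb , _ rewrite χa | χb =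
              xor-assoc-≢ d (open-ends I same a≢b (proj₁ (open-insertEdge merged a-open))
                                                  (proj₁ (open-insertEdge merged b-open)))
      merged-open-ends {a = a} {b} same′ a≢b a-open b-open | no apart-ab with side a | side b
      ... | fromY aY _ _   | fromY bY _ _   = contradiction (trans aY (sym bY)) apart-ab
      ... | other _ ca _   | other _ cb _   = contradiction (trans (sym ca) (trans same′ cb)) apart-ab
      ... | fromY aY ca χa | other _ cb χb  =
            cross-ends aY (trans (sym cb) (trans (sym same′) ca)) χa χb a-open b-open
      ... | other _ ca χa  | fromY bY cb χb =
            cross-ends bY (trans (sym ca) (trans same′ cb)) χb χa b-open a-open ∘ sym

      join : Invariant (insertEdge t x y merged)
      join = record
        { proper    = insertEdge-proper merged _ mxy old-edge new-edge
                                        (proj₁ new-edge ∘ sym , sym (proj₂ new-edge))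
        ; open-ends = merged-open-ends
        }

  Extension : State → Bool → X → Set
  Extension σ t x = Σ State λ σ′ → Invariant σ′ × σ ⊑ σ′ × Covered σ′ t x

  step : (σ : State) → Invariant σ → ∀ t x → Extension σ t x
  step σ I t x with m t x in mxy
  ... | nothing = σ , I , id , λ ()
  ... | just y with inserted σ t x in x-ins | inserted σ t y in y-ins
  ...   | true  | _    = σ , I , id , λ _ → inj₁ x-ins
  ...   | false | true = σ , I , id , λ { refl → inj₂ y-ins }
  ...   | false | false with component σ x ≟ component σ y
  ...     | yes same  = _ , close same , insertEdge-⊒ {t} {x} {y} σ ,
                        λ _ → inj₁ (insertEdge-covers {t} {x} {y} σ)
    where open Insert σ I mxy x-ins y-ins
  ...     | no  apart = _ , join , insertEdge-⊒ {t} {x} {y} merged ,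
                        λ _ → inj₁ (insertEdge-covers {t} {x} {y} merged)
    where open Insert σ I mxy x-ins y-ins
          open Merge apart

  run : (σ : State) → Invariant σ → (todo : List (Bool × X)) →
        Σ State λ σ′ → Invariant σ′ × σ ⊑ σ′ × (∀ {t x} → (t , x) ∈ todo → Covered σ′ t x)
  run σ I [] = σ , I , id , λ ()
  run σ I ((t , x) ∷ todo) with step σ I t x
  ... | σ₁ , I₁ , σ⊑σ₁ , covered₁ with run σ₁ I₁ todo
  ...   | σ₂ , I₂ , σ₁⊑σ₂ , covered₂ =
          σ₂ , I₂ , σ₁⊑σ₂ ∘ σ⊑σ₁ ,
          λ { (here refl) → Covered-mono {σ₁} {σ₂} {t} {x} σ₁⊑σ₂ covered₁ ; (there p) → covered₂ p }

  two-colouring : (xs : List X) → (∀ x → x ∈ xs) →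
                  Σ (X → Bool) λ χ → ∀ {t x y} → m t x ≡ just y → χ x ≢ χ y
  two-colouring xs enum with run initial initial-invariant (cartesianProduct (false ∷ true ∷ []) xs)
  ... | σ , I , _ , covered = colour σ , proper′
    where
    bools : ∀ t → t ∈ false ∷ true ∷ []
    bools false = here refl
    bools true  = there (here refl)

    proper′ : ∀ {t x y} → m t x ≡ just y → colour σ x ≢ colour σ y
    proper′ {t} {x} mxy with covered (∈-cartesianProduct⁺ (bools t) (enum x)) mxy
    ... | inj₁ x-ins = proj₁ (proper I mxy x-ins)
    ... | inj₂ y-ins = proj₁ (proper I (m-sym mxy) y-ins) ∘ sym

-- Degeneracy orderings

neighbours : ∀ {n} → Graph n → Fin n → List (Fin n)
neighbours {n} G v = filterᵇ (adj G v) (allFin n)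

neighbours-unique : ∀ {n} (G : Graph n) v → Unique (neighbours G v)
neighbours-unique {n} G v = filter⁺ (T? ∘ adj G v) (allFin⁺ n)

↭-neighbours-unique : ∀ {n} (G : Graph n) {v l} → l ↭ neighbours G v → Unique l
↭-neighbours-unique {n} G {v} l↭ =
  Permutationₛ.Unique-resp-↭ (setoid (Fin n)) (↭⇒↭ₛ (↭-sym l↭)) (neighbours-unique G v)

Degenerate : ℕ → ∀ {n} → Graph n → Set
Degenerate k G =
  (H : Subgraph G) → ∃ (λ v → vs H v ≡ true) → ∃ (λ v → (vs H v ≡ true) × (degree (es H) v ≤ k))

higherNeighbours : ∀ {n} → Graph n → (Fin n → ℕ) → Fin n → List (Fin n)
higherNeighbours G rank v = filterᵇ (λ u → rank v <ᵇ rank u) (neighbours G v)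

record DegeneracyOrder {n} (G : Graph n) (k : ℕ) : Set where
  field
    rank           : Fin n → ℕ
    rank-injective : ∀ {u v} → rank u ≡ rank v → u ≡ v
    few-higher     : ∀ v → length (higherNeighbours G rank v) ≤ k

module _ {n} (G : Graph n) {k} (degenerate : Degenerate k G) where

  induced : (Fin n → Bool) → Subgraph G
  induced S = record
    { vs     = S
    ; es     = λ u v → adj G u v ∧ (S u ∧ S v)
    ; es-sym = λ u v → cong₂ _∧_ (Graph.sym G u v) (∧-comm (S u) (S v))
    ; es-sub = λ u v uv → let adj-uv , Suv = ∧-≡-true uv in adj-uv , ∧-≡-true Suv
    }

  size : (Fin n → Bool) → ℕ
  size S = length (filterᵇ S (allFin n))

  _∖_ : (Fin n → Bool) → Fin n → Fin n → Bool
  (S ∖ v) u = S u ∧ not (does (u ≟ v))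

  size-∖ : ∀ {S v} → S v ≡ true → size (S ∖ v) < size S
  size-∖ {S} {v} Sv rewrite filterᵇ-∧ S (λ u → not (does (u ≟ v))) (allFin n) =
    filter-notAll _ _ (Any.map (λ { refl → removed })
                               (∈-filter⁺ (T? ∘ S) (∈-allFin v) (Equivalence.from T-≡ Sv)))
    where
    removed : ¬ T (not (does (v ≟ v)))
    removed rewrite dec-true (v ≟ v) refl = λ ()

  higherIn : (Fin n → Bool) → (Fin n → ℕ) → Fin n → List (Fin n)
  higherIn S rank v = filterᵇ (λ u → S u ∧ (rank v <ᵇ rank u)) (neighbours G v)

  record OrderOn (S : Fin n → Bool) : Set where
    field
      rank       : Fin n → ℕ
      injective  : ∀ {u v} → S u ≡ true → S v ≡ true → rank u ≡ rank v → u ≡ v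
      few-higher : ∀ {v} → S v ≡ true → length (higherIn S rank v) ≤ k

  module PutFirst {S v} (Sv : S v ≡ true) (low-degree : degree (es (induced S)) v ≤ k)
                  (order : OrderOn (S ∖ v)) where
    open OrderOn order renaming (rank to rank′; injective to injective′; few-higher to few-higher′)

    rank : Fin n → ℕ
    rank u = if does (u ≟ v) then 0 else suc (rank′ u)

    rank-v : rank v ≡ 0
    rank-v rewrite dec-true (v ≟ v) refl = refl

    rank-other : ∀ {u} → u ≢ v → rank u ≡ suc (rank′ u)
    rank-other {u} u≢v rewrite dec-false (u ≟ v) u≢v = refl

    ∈S∖v : ∀ {u} → u ≢ v → S u ≡ true → (S ∖ v) u ≡ true
    ∈S∖v {u} u≢v Su rewrite Su | dec-false (u ≟ v) u≢v = refl

    injective : ∀ {u w} → S u ≡ true → S w ≡ true → rank u ≡ rank w → u ≡ w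
    injective {u} {w} Su Sw eq with u ≟ v | w ≟ v
    ... | yes refl | yes refl = refl
    ... | no u≢v   | no w≢v   = injective′ (∈S∖v u≢v Su) (∈S∖v w≢v Sw) (suc-injective eq)

    few-higher-v : length (higherIn S rank v) ≤ k
    few-higher-v = begin
      length (higherIn S rank v)                           ≤⟨ length-filterᵇ-mono in-S (neighbours G v) ⟩
      length (filterᵇ (λ u → S v ∧ S u) (neighbours G v))  ≡⟨ cong length (filterᵇ-∧ (adj G v) _ (allFin n)) ⟨
      degree (es (induced S)) v                            ≤⟨ low-degree ⟩
      k                                                    ∎
      where
      open ≤-Reasoning
      in-S : ∀ {u} → T (S u ∧ (rank v <ᵇ rank u)) → T (S v ∧ S u)
      in-S h rewrite Sv = proj₁ (Equivalence.to T-∧ h)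

    few-higher-other : ∀ {w} → w ≢ v → S w ≡ true → length (higherIn S rank w) ≤ k
    few-higher-other {w} w≢v Sw =
      ≤-trans (length-filterᵇ-mono still-higher (neighbours G w)) (few-higher′ (∈S∖v w≢v Sw))
      where
      still-higher : ∀ {u} → T (S u ∧ (rank w <ᵇ rank u)) → T ((S ∖ v) u ∧ (rank′ w <ᵇ rank′ u))
      still-higher {u} h =
        let Su , w<u = Equivalence.to T-∧ h in by-cases (u ≟ v) Su (<ᵇ⇒< _ _ w<u)
        where
        by-cases : Dec (u ≡ v) → T (S u) → rank w < rank u → T ((S ∖ v) u ∧ (rank′ w <ᵇ rank′ u))
        by-cases (yes refl) _  w<v = contradiction (subst₂ _<_ (rank-other w≢v) rank-v w<v) λ ()
        by-cases (no u≢v)   Su w<u = Equivalence.from T-∧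
          ( Equivalence.from T-≡ (∈S∖v u≢v (Equivalence.to T-≡ Su))
          , <⇒<ᵇ (s<s⁻¹ (subst₂ _<_ (rank-other w≢v) (rank-other u≢v) w<u)) )

    few-higher : ∀ {w} → S w ≡ true → length (higherIn S rank w) ≤ k
    few-higher {w} Sw = by-cases (w ≟ v)
      where
      by-cases : Dec (w ≡ v) → length (higherIn S rank w) ≤ k
      by-cases (yes refl) = few-higher-v
      by-cases (no w≢v)   = few-higher-other w≢v Sw

    ordered : OrderOn S
    ordered = record { rank = rank ; injective = injective ; few-higher = few-higher }

  orderOn : ∀ S → Acc _<_ (size S) → OrderOn S
  orderOn S (acc smaller) with any? (λ v → S v ≟ᵇ true)
  ... | no empty = record
    { rank       = λ _ → 0
    ; injective  = λ Su _ _ → contradiction (_ , Su) empty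
    ; few-higher = λ Sv → contradiction (_ , Sv) empty
    }
  ... | yes nonempty with degenerate (induced S) nonempty
  ...   | v , Sv , low-degree = PutFirst.ordered Sv low-degree (orderOn (S ∖ v) (smaller (size-∖ Sv)))

  degeneracyOrder : DegeneracyOrder G k
  degeneracyOrder = record
    { rank           = rank
    ; rank-injective = injective refl refl
    ; few-higher     = λ v → few-higher refl
    }
    where open OrderOn (orderOn (λ _ → true) (<-wellFounded _))

-- Acyclicity from a ranking with at most one higher neighbour

module RankedAcyclicity {n : ℕ} (A : Rel n)
  (A-sym : ∀ {u v} → A u v ≡ true → A v u ≡ true)
  (rank : Fin n → ℕ)
  (rank-≢ : ∀ {u v} → A u v ≡ true → rank u ≢ rank v)
  (one-higher : ∀ {v u w} → A v u ≡ true → A v w ≡ true → rank v < rank u → rank v < rank w → u ≡ w)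
  where

  NonBacktracking : List (Fin n) → Set
  NonBacktracking (a ∷ b ∷ c ∷ l) = a ≢ c × NonBacktracking (b ∷ c ∷ l)
  NonBacktracking _               = ⊤

  LastStepUp : List (Fin n) → Set
  LastStepUp (a ∷ b ∷ [])     = rank a < rank b
  LastStepUp (_ ∷ b ∷ c ∷ l)  = LastStepUp (b ∷ c ∷ l)
  LastStepUp _                = ⊥

  Ascending Descending : List (Fin n) → Set
  Ascending  = Linked (_<_ on rank)
  Descending = Linked (_>_ on rank)

  down-then-down : ∀ {a b c} → A a b ≡ true → A b c ≡ true → a ≢ c → rank b < rank a → rank c < rank b
  down-then-down {a} {b} {c} ab bc a≢c b<a with <-cmp (rank c) (rank b)
  ... | tri< c<b _ _ = c<b
  ... | tri≈ _ c≡b _ = contradiction (sym c≡b) (rank-≢ bc)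
  ... | tri> _ _ b<c = contradiction (one-higher (A-sym ab) bc b<a b<c) a≢c

  descent : ∀ {a b} l → AdjChain A (a ∷ b ∷ l) → NonBacktracking (a ∷ b ∷ l) →
            rank b < rank a → Descending (a ∷ b ∷ l)
  descent []      _              _          b<a = b<a ∷ [-]
  descent (c ∷ l) (ab , bc , ch) (a≢c , nb) b<a =
    b<a ∷ descent l (bc , ch) nb (down-then-down ab bc a≢c b<a)

  ascent : ∀ {a b} l → AdjChain A (a ∷ b ∷ l) → NonBacktracking (a ∷ b ∷ l) →
           LastStepUp (a ∷ b ∷ l) → Ascending (a ∷ b ∷ l)
  ascent []      _              _          a<b = a<b ∷ [-]
  ascent {a} {b} (c ∷ l) (ab , bc , ch) (a≢c , nb) up with ascent l (bc , ch) nb up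
  ... | b<c ∷ asc with <-cmp (rank a) (rank b)
  ...   | tri< a<b _ _ = a<b ∷ b<c ∷ asc
  ...   | tri≈ _ a≡b _ = contradiction a≡b (rank-≢ ab)
  ...   | tri> _ _ b<a = contradiction b<c (<-asym (down-then-down ab bc a≢c b<a))

  LastStepUp-++ : ∀ {z x} l → rank z < rank x → LastStepUp (l ++ z ∷ x ∷ [])
  LastStepUp-++ []              z<x = z<x
  LastStepUp-++ (_ ∷ [])        z<x = z<x
  LastStepUp-++ (_ ∷ _ ∷ [])    z<x = z<x
  LastStepUp-++ (_ ∷ b ∷ c ∷ l) z<x = LastStepUp-++ (b ∷ c ∷ l) z<x

  adjChain-last : ∀ {z x} l → AdjChain A (l ++ z ∷ x ∷ []) → A z x ≡ true
  adjChain-last []          (zx , _) = zx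
  adjChain-last (_ ∷ [])    (_ , ch) = adjChain-last [] ch
  adjChain-last (_ ∷ b ∷ l) (_ , ch) = adjChain-last (b ∷ l) ch

  nonBacktracking-++ : ∀ {a b e} l → Unique (a ∷ b ∷ l) → All (_≢ e) (a ∷ b ∷ l) →
                       NonBacktracking (a ∷ b ∷ l ++ e ∷ [])
  nonBacktracking-++ []      _                   (a≢e ∷ _)    = a≢e , tt
  nonBacktracking-++ (c ∷ l) ((_ ∷ a≢c ∷ _) ∷ u) (_ ∷ others) = a≢c , nonBacktracking-++ l u others

  nonBacktracking-closed : ∀ {x} l → Unique (x ∷ l) → 2 ≤ length l → NonBacktracking (x ∷ l ++ x ∷ [])
  nonBacktracking-closed (_ ∷ [])    _                          (s≤s ())
  nonBacktracking-closed (_ ∷ _ ∷ l) ((x≢y ∷ x≢w ∷ x∉l) ∷ u) _ =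
    x≢w , nonBacktracking-++ l u (All.map (_∘ sym) (x≢y ∷ x≢w ∷ x∉l))

  no-return : ∀ (R : ℕ → ℕ → Set) → (∀ {i j k} → R i j → R j k → R i k) → (∀ {i} → ¬ R i i) →
              ∀ {x l} → Linked (R on rank) (x ∷ l) → x ∉ l
  no-return _ trans irrefl linked x∈l with Linked⇒AllPairs trans linked
  ... | from-x ∷ _ = irrefl (All.lookup from-x x∈l)

  ascending-no-return : ∀ {x l} → Ascending (x ∷ l) → x ∉ l
  ascending-no-return = no-return _<_ <-trans (<-irrefl refl)

  descending-no-return : ∀ {x l} → Descending (x ∷ l) → x ∉ l
  descending-no-return = no-return _>_ (λ p q → <-trans q p) (<-irrefl refl)

  -- The closed walk x y … z x cannot start downwards (it would then descend all the way back to
  -- x) nor end upwards (it would then have ascended all the way), so y and z are two different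
  -- higher neighbours of x.

  acyclic : ¬ HasCycle A
  acyclic (x , xs , len , uniq , chain) with initLast xs
  acyclic (x , _ , s≤s () , _) | [] ∷ʳ′ z
  acyclic (x , _ , len , uniq@(_ ∷ (y≢rest ∷ _)) , chain) | (y ∷ ms) ∷ʳ′ z =
    contradiction (one-higher (proj₁ chain) (A-sym zx) x<y x<z) y≢z
    where
    walk : List (Fin n)
    walk = x ∷ y ∷ ms ++ z ∷ x ∷ []

    walk-chain : AdjChain A walk
    walk-chain = subst (λ l → AdjChain A (x ∷ y ∷ l)) (++-assoc ms (z ∷ []) (x ∷ [])) chain

    walk-nb : NonBacktracking walk
    walk-nb = subst (λ l → NonBacktracking (x ∷ y ∷ l)) (++-assoc ms (z ∷ []) (x ∷ []))
                    (nonBacktracking-closed ((y ∷ ms) ∷ʳ z) uniq len)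

    x∈walk : x ∈ y ∷ ms ++ z ∷ x ∷ []
    x∈walk = there (∈-++⁺ʳ ms (there (here refl)))

    zx : A z x ≡ true
    zx = adjChain-last (x ∷ y ∷ ms) walk-chain

    y≢z : y ≢ z
    y≢z = All.lookup y≢rest (∈-++⁺ʳ ms (here refl))

    x<y : rank x < rank y
    x<y with <-cmp (rank x) (rank y)
    ... | tri< x<y _ _ = x<y
    ... | tri≈ _ x≡y _ = contradiction x≡y (rank-≢ (proj₁ chain))
    ... | tri> _ _ y<x = ⊥-elim (descending-no-return (descent _ walk-chain walk-nb y<x) x∈walk)

    x<z : rank x < rank z
    x<z with <-cmp (rank x) (rank z)
    ... | tri< x<z _ _ = x<z
    ... | tri≈ _ x≡z _ = contradiction (sym x≡z) (rank-≢ zx)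
    ... | tri> _ _ z<x =
          ⊥-elim (ascending-no-return (ascent _ walk-chain walk-nb (LastStepUp-++ (x ∷ y ∷ ms) z<x)) x∈walk)

-- Edge colourings separating paired edges

module FinPairing {n : ℕ} = Pairing (_≟_ {n})
open FinPairing using (partner; partner-first; partner-sym; partner-irrefl; partner-prefix; Separated;
                       length-filterᵇ-separated)

Separates : ∀ {n} (G : Graph n) → (Fin n → List (Fin n)) → EdgeColouring G → Set
Separates G Q c = ∀ v {a b} → partner (Q v) a ≡ just b → col c v a ≢ col c v b

bit : Bool → Fin 2
bit false = zero
bit true  = suc zero

bit-injective : ∀ {a b} → bit a ≡ bit b → a ≡ b
bit-injective {false} {false} _ = refl
bit-injective {true}  {true}  _ = refl

separatingColouring : ∀ {n} (G : Graph n) → Bipartite G → (Q : Fin n → List (Fin n)) →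
                      (∀ v → Unique (Q v)) → Σ (EdgeColouring G) (Separates G Q)
separatingColouring {n} G (side , proper) Q unique = edgeColouring , separates
  where
  -- The edge uv with side u ≡ true is represented by (u , v). The matching m false joins the
  -- representatives of edges paired at their first end, m true those of edges paired at their
  -- second end; pairs that are not edges are matched too, which does no harm.
  m : Bool → Fin n × Fin n → Maybe (Fin n × Fin n)
  m false (a , b) = Maybe.map (a ,_) (partner (Q a) b)
  m true  (a , b) = Maybe.map (_, b) (partner (Q b) a)

  m-sym : ∀ {t x y} → m t x ≡ just y → m t y ≡ just x
  m-sym {false} {a , b} _ with partner (Q a) b in ab
  m-sym {false} {a , b} refl | just _ rewrite partner-sym (unique a) ab = refl
  m-sym {true}  {a , b} _ with partner (Q b) a in ab
  m-sym {true}  {a , b} refl | just _ rewrite partner-sym (unique b) ab = refl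

  m-irrefl : ∀ {t x y} → m t x ≡ just y → x ≢ y
  m-irrefl {false} {a , b} _ with partner (Q a) b in ab
  m-irrefl {false} {a , b} refl | just _ = partner-irrefl (unique a) ab ∘ cong proj₂
  m-irrefl {true}  {a , b} _ with partner (Q b) a in ab
  m-irrefl {true}  {a , b} refl | just _ = partner-irrefl (unique b) ab ∘ cong proj₁

  open UnionOfTwoMatchings (≡-dec _≟_ _≟_) m (λ {t} → m-sym {t}) (λ {t} → m-irrefl {t})
    using (two-colouring)

  colouring : Σ (Fin n × Fin n → Bool) λ χ → ∀ {t x y} → m t x ≡ just y → χ x ≢ χ y
  colouring = two-colouring (cartesianProduct (allFin n) (allFin n))
                            (λ (a , b) → ∈-cartesianProduct⁺ (∈-allFin a) (∈-allFin b))

  χ : Fin n × Fin n → Bool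
  χ = proj₁ colouring

  χ-proper : ∀ {t x y} → m t x ≡ just y → χ x ≢ χ y
  χ-proper {t} = proj₂ colouring {t}

  orient : Fin n → Fin n → Fin n × Fin n
  orient u w = if side u then (u , w) else (w , u)

  orient-sym : ∀ {u w} → adj G u w ≡ true → orient u w ≡ orient w u
  orient-sym {u} {w} uw with side u in su | side w in sw
  ... | true  | false = refl
  ... | false | true  = refl
  ... | true  | true  = contradiction (trans su (sym sw)) (proper u w uw)
  ... | false | false = contradiction (trans su (sym sw)) (proper u w uw)

  edgeColouring : EdgeColouring G
  edgeColouring = record
    { col     = λ u w → bit (χ (orient u w))
    ; col-sym = λ u w uw → cong (bit ∘ χ) (orient-sym uw)
    }

  separates : Separates G Q edgeColouring
  separates v {a} {b} ab with side v
  ... | true  = χ-proper {false} {v , a} (cong (Maybe.map (v ,_)) ab) ∘ bit-injective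
  ... | false = χ-proper {true}  {a , v} (cong (Maybe.map (_, v)) ab) ∘ bit-injective

colourClass-edge : ∀ {n} {G : Graph n} (c : EdgeColouring G) {i u v} →
                   colourClass c i u v ≡ true → adj G u v ≡ true × col c u v ≡ i
colourClass-edge c uv with ∧-≡-true uv
... | adj-uv , is-i = adj-uv , toWitness (Equivalence.from T-≡ is-i)

colourClass-intro : ∀ {n} {G : Graph n} (c : EdgeColouring G) {i u v} →
                    adj G u v ≡ true → col c u v ≡ i → colourClass c i u v ≡ true
colourClass-intro c adj-uv col-uv rewrite adj-uv = Equivalence.to T-≡ (fromWitness col-uv)

module SeparatingColouring {n} {G : Graph n} (c : EdgeColouring G) (Q : Fin n → List (Fin n))
  (Q↭ : ∀ v → Q v ↭ neighbours G v) (separates : Separates G Q c) where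

  Q-adj : ∀ {v u} → u ∈ Q v → adj G v u ≡ true
  Q-adj {v} u∈Q =
    Equivalence.to T-≡ (proj₂ (∈-filter⁻ (T? ∘ adj G v) {xs = allFin n} (∈-resp-↭ (Q↭ v) u∈Q)))

  colourClass-degree : ∀ i v → degree (colourClass c i) v ≤ ⌈ degree (adj G) v /2⌉
  colourClass-degree i v = begin
    degree (colourClass c i) v              ≡⟨ cong length (filterᵇ-∧ (adj G v) is-i (allFin n)) ⟩
    length (filterᵇ is-i (neighbours G v))  ≡⟨ ↭-length (filter-↭ (T? ∘ is-i) (Q↭ v)) ⟨
    length (filterᵇ is-i (Q v))             ≤⟨ length-filterᵇ-separated is-i Q-unique i-separated ⟩
    ⌈ length (Q v) /2⌉                      ≡⟨ cong ⌈_/2⌉ (↭-length (Q↭ v)) ⟩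
    ⌈ degree (adj G) v /2⌉                  ∎
    where
    open ≤-Reasoning
    is-i : Fin n → Bool
    is-i u = ⌊ col c v u ≟ i ⌋
    Q-unique : Unique (Q v)
    Q-unique = ↭-neighbours-unique G (Q↭ v)
    i-separated : Separated is-i (Q v)
    i-separated ab a-is-i b-is-i = separates v ab (trans (toWitness a-is-i) (sym (toWitness b-is-i)))

  not-monochromatic : ∀ v → ¬ Monochromatic c v
  not-monochromatic v (degree≡2 , monochromatic) with Q v in Qv | ↭-length (Q↭ v)
  ... | a ∷ b ∷ [] | _ =
        separates v (subst (λ l → partner l a ≡ just b) (sym Qv) (partner-first {a = a} {b = b} {l = []}))
                    (monochromatic a b (Q-adj (subst (a ∈_) (sym Qv) (here refl)))
                                       (Q-adj (subst (b ∈_) (sym Qv) (there (here refl)))))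
  ... | []            | len = contradiction (trans len degree≡2) λ ()
  ... | _ ∷ []        | len = contradiction (trans len degree≡2) λ ()
  ... | _ ∷ _ ∷ _ ∷ _ | len = contradiction (trans len degree≡2) λ ()

module _ {n} {G : Graph n} (order : DegeneracyOrder G 2) where
  open DegeneracyOrder order

  -- A vertex has at most two higher neighbours, so they form a pair.
  pairing : Fin n → List (Fin n)
  pairing v = higherNeighbours G rank v ++ filterᵇ (not ∘ (λ u → rank v <ᵇ rank u)) (neighbours G v)

  pairing-↭ : ∀ v → pairing v ↭ neighbours G v
  pairing-↭ v = filterᵇ-partition-↭ _ (neighbours G v)

  colourClass-acyclic : (c : EdgeColouring G) → Separates G pairing c → ∀ i →
                        ¬ HasCycle (colourClass c i)
  colourClass-acyclic c separates i =
    RankedAcyclicity.acyclic (colourClass c i) A-sym rank rank-≢ one-higher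
    where
    A-sym : ∀ {u v} → colourClass c i u v ≡ true → colourClass c i v u ≡ true
    A-sym {u} {v} uv with colourClass-edge c uv
    ... | adj-uv , col-uv =
          colourClass-intro c (trans (Graph.sym G v u) adj-uv)
                              (trans (sym (col-sym c u v adj-uv)) col-uv)

    rank-≢ : ∀ {u v} → colourClass c i u v ≡ true → rank u ≢ rank v
    rank-≢ {u} uv same with rank-injective same
    ... | refl = contradiction (trans (sym (proj₁ (colourClass-edge c uv))) (Graph.irrefl G u)) λ ()

    higher : ∀ {v u} → adj G v u ≡ true → rank v < rank u → u ∈ higherNeighbours G rank v
    higher vu v<u = ∈-filter⁺ _ (∈-filter⁺ _ (∈-allFin _) (Equivalence.from T-≡ vu)) (<⇒<ᵇ v<u)

    one-higher : ∀ {v u w} → colourClass c i v u ≡ true → colourClass c i v w ≡ true →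
                 rank v < rank u → rank v < rank w → u ≡ w
    one-higher {v} {u} {w} vu vw v<u v<w with u ≟ w | colourClass-edge c vu | colourClass-edge c vw
    ... | yes u≡w | _ | _ = u≡w
    ... | no u≢w | adj-vu , col-u | adj-vw , col-w =
          contradiction (trans col-u (sym col-w))
            (separates v (partner-prefix _ (few-higher v) (higher adj-vu v<u) (higher adj-vw v<w) u≢w))

theorem4 : (n : ℕ) (G : Graph n) → Bipartite G → TwoDegenerate G → MaxDegreeAtMost G 4 →
    Σ (EdgeColouring G) λ c → TwoLinearColouring c × (∀ v → ¬ Monochromatic c v)
theorem4 n G bipartite degenerate max-degree = c , linear , not-monochromatic
  where
  order : DegeneracyOrder G 2
  order = degeneracyOrder G degenerate

  coloured : Σ (EdgeColouring G) (Separates G (pairing order))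
  coloured = separatingColouring G bipartite (pairing order) (↭-neighbours-unique G ∘ pairing-↭ order)

  c : EdgeColouring G
  c = proj₁ coloured

  separates : Separates G (pairing order) c
  separates = proj₂ coloured

  open SeparatingColouring c (pairing order) (pairing-↭ order) separates

  linear : TwoLinearColouring c
  linear i = colourClass-acyclic order c separates i
           , λ v → ≤-trans (colourClass-degree i v) (⌈n/2⌉-mono (max-degree v))
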